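{- For every tree $t$ on $n$ vertices, $$D_{max}^t \ge D_{max}^{star} = \binom n2,$$ where $D_{max}^{star}$ is $D_{max}$ of the star tree on $n$ vertices.
   Context: A linear arrangement of a tree on $n$ vertices is a bijection $\pi$ from its vertex set to $\{1,\dots,n\}$; $D(\pi)=\sum_{\{u,v\}\in E}|\pi(u)-\pi(v)|$, and $D_{max}^t$ is the maximum of $D(\pi)$ over all linear arrangements of $t$. The star tree on $n$ vertices has one vertex adjacent to all other $n-1$ vertices. -}

module Defs where

open import Data.Nat using (ℕ; zero; suc; _+_; _≤_; _<_; ∣_-_∣)
open import Data.Bool using (Bool; true; false; if_then_else_)
open import Data.Fin using (Fin; toℕ; _<?_)
open import Data.Fin.Permutation using (Permutation′; _⟨$⟩ʳ_)
open import Data.List using (List; []; _∷_; map; allFin)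
open import Data.Nat.ListAction using (sum)
open import Data.Empty using (⊥)
open import Data.List.Relation.Unary.Unique.Propositional using (Unique)
open import Data.Product using (Σ; _×_; ∃)
open import Relation.Binary.PropositionalEquality using (_≡_)
open import Relation.Nullary using (¬_; does)

record Graph (n : ℕ) : Set where
  field
    adj   : Fin n → Fin n → Bool
    sym   : ∀ u v → adj u v ≡ adj v u
    irref : ∀ u → adj u u ≡ false
open Graph public

Adj : ∀ {n} → Graph n → Fin n → Fin n → Set
Adj G u v = adj G u v ≡ true

data Walk {n : ℕ} (G : Graph n) : Fin n → Fin n → Set where
  here : ∀ {u} → Walk G u u
  step : ∀ {u w v} → Adj G u w → Walk G w v → Walk G u v

Connected : ∀ {n} → Graph n → Set
Connected G = ∀ u v → Walk G u v

data Chain {n : ℕ} (G : Graph n) : List (Fin n) → Set where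
  nil  : Chain G []
  one  : ∀ {u} → Chain G (u ∷ [])
  cons : ∀ {u v vs} → Adj G u v → Chain G (v ∷ vs) → Chain G (u ∷ v ∷ vs)

lastV : ∀ {n} → Fin n → List (Fin n) → Fin n
lastV x [] = x
lastV x (y ∷ ys) = lastV y ys

IsCycle : ∀ {n} → Graph n → List (Fin n) → Set
IsCycle G [] = ⊥
IsCycle G (_ ∷ []) = ⊥
IsCycle G (_ ∷ _ ∷ []) = ⊥
IsCycle G (v₀ ∷ v₁ ∷ v₂ ∷ vs) =
  Unique (v₀ ∷ v₁ ∷ v₂ ∷ vs) × Chain G (v₀ ∷ v₁ ∷ v₂ ∷ vs) × Adj G (lastV v₂ vs) v₀

Acyclic : ∀ {n} → Graph n → Set
Acyclic G = ∀ vs → ¬ IsCycle G vs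

IsTree : ∀ {n} → Graph n → Set
IsTree G = Connected G × Acyclic G

-- a linear arrangement is a bijection π : V → {1..n}; we use positions
-- 0..n-1 (Fin n), which does not change the differences |π(u) - π(v)|.
Arrangement : ℕ → Set
Arrangement n = Permutation′ n

D : ∀ {n} → Graph n → Arrangement n → ℕ
D {n} G π = sum (map (λ u → sum (map (λ v → term u v) (allFin n))) (allFin n))
  where
  term : Fin n → Fin n → ℕ
  term u v = if does (u <? v) then (if adj G u v then ∣ toℕ (π ⟨$⟩ʳ u) - toℕ (π ⟨$⟩ʳ v) ∣ else 0) else 0

IsDmax : ∀ {n} → Graph n → ℕ → Set
IsDmax G d = (∃ λ π → D G π ≡ d) × (∀ π → D G π ≤ d)

open import Data.Fin using (zero; suc)
starAdj : ∀ {m} → Fin (suc m) → Fin (suc m) → Bool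
starAdj zero zero = false
starAdj zero (suc _) = true
starAdj (suc _) zero = true
starAdj (suc _) (suc _) = false

star : (m : ℕ) → Graph (suc m)
star m = record { adj = starAdj ; sym = s ; irref = i }
  where
  open Relation.Binary.PropositionalEquality using (refl)
  s : ∀ u v → starAdj u v ≡ starAdj v u
  s zero zero = refl
  s zero (suc _) = refl
  s (suc _) zero = refl
  s (suc _) (suc _) = refl
  i : ∀ u → starAdj u u ≡ false
  i zero = refl
  i (suc _) = refl

-- Star: D(π) is the total distance from the centre's position p to all positions,
-- Σⱼ |p − j| = C(p+1,2) + C(n−p,2) ≤ C(n,2), with equality for p = 0.
--
-- Trees (only connectivity is used): place the vertices one at a time, each next to an
-- already placed parent, while keeping a cut of the line that every parent edge placed so
-- far crosses. The next vertex is inserted at the cut, which then moves by at most one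
-- place so as to separate it from its parent as well. Every insertion at the cut
-- lengthens each earlier parent edge by one, so the parent edges of the non-root vertices
-- have lengths at least 1, 2, …, n − 1, summing to C(n,2). Distinct vertices have
-- distinct parent edges, so D(π) is at least this sum.

module Submission where

open import Defs hiding (sym)
open import Data.Nat using (ℕ; zero; suc; _+_; _*_; _∸_; _≤_; _<_; z≤n; s≤s; ∣_-_∣)
open import Data.Nat.Properties
  using (+-0-commutativeMonoid; +-identityʳ; +-mono-≤; ≤-refl; ≤-reflexive; ≤-trans; m≤m+n;
         <⇒≤; m≤n⇒m≤1+n; +-∸-assoc; m≤n⇒∣m-n∣≡n∸m; ∣m-n∣≡0⇒m≡n; ∣n-n∣≡0; ∣-∣-comm; n≢0⇒n>0;
         m≤n⇒∃[o]m+o≡n; ≤-pred; ≤-antisym; ≮⇒≥; <⇒≱; 1+n≰n; <-trans; <-irrefl; <-≤-trans; n<1+n; n≤1+n; module ≤-Reasoning)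
open import Data.Nat.Combinatorics using (_C_; nC1≡n; nCk+nC[k+1]≡[n+1]C[k+1])
open import Data.Nat.ListAction using () renaming (sum to sumˡ)
open import Data.Nat.Tactic.RingSolver using (solve-∀)
open import Data.Fin using (Fin; zero; suc; toℕ; _<?_; punchIn; punchOut; inject₁; fromℕ)
open import Data.Fin.Properties
  using (_≟_; toℕ-injective; toℕ<n; toℕ-inject₁; punchInᵢ≢i; punchOut-injective; <⇒≢; any?; all?; ¬∀⟶∃¬; injective⇒≤)
open import Data.Fin.Permutation using (Permutation′; _⟨$⟩ʳ_; _⟨$⟩ˡ_; _∘ₚ_)
import Data.Fin.Permutation as Perm
open import Data.List using (map; tabulate; allFin)
open import Data.Vec.Functional using (_∷_)
open import Data.List.Properties using (map-tabulate)
open import Data.Bool using (Bool; true; false; if_then_else_)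
open import Data.Product as Product using (_×_; _,_; ∃; ∃₂; proj₁; proj₂)
open import Data.Sum as Sum using (_⊎_; inj₁; inj₂)
open import Relation.Unary using (Pred; Decidable)
open import Function.Definitions using (Injective)
open import Function using (_∘_; id)
open import Relation.Nullary using (Dec; does; yes; no; ¬_; contradiction)
open import Relation.Nullary.Decidable using (dec-true; dec-false)
open import Relation.Binary.PropositionalEquality
open import Algebra.Properties.CommutativeMonoid.Sum +-0-commutativeMonoid
  using (sum-syntax; sum-cong-≗; sum-remove; sum-replicate-zero; sum-init-last; ∑-distrib-+; ∑-comm; ∑-permute)

∑-mono-≤ : ∀ {k} {f g : Fin k → ℕ} → (∀ i → f i ≤ g i) → ∑[ i < k ] f i ≤ ∑[ i < k ] g i
∑-mono-≤ {zero}  f≤g = z≤n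
∑-mono-≤ {suc k} f≤g = +-mono-≤ (f≤g zero) (∑-mono-≤ (f≤g ∘ suc))

∑-zero : ∀ {k} {f : Fin k → ℕ} → (∀ i → f i ≡ 0) → ∑[ i < k ] f i ≡ 0
∑-zero {k} vanish = trans (sum-cong-≗ vanish) (sum-replicate-zero k)

∑-select : ∀ {k} (f : Fin k → ℕ) (i : Fin k) → (∀ j → j ≢ i → f j ≡ 0) → ∑[ j < k ] f j ≡ f i
∑-select {suc k} f i vanish = begin
  ∑[ j < suc k ] f j                ≡⟨ sum-remove f ⟩
  f i + ∑[ j < k ] f (punchIn i j)  ≡⟨ cong (f i +_) (∑-zero (λ j → vanish _ (punchInᵢ≢i i j))) ⟩
  f i + 0                           ≡⟨ +-identityʳ (f i) ⟩
  f i                               ∎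
  where open ≡-Reasoning

∑-one : ∀ k → ∑[ i < k ] 1 ≡ k
∑-one zero    = refl
∑-one (suc k) = cong suc (∑-one k)

[1+n]C2≡n+nC2 : ∀ n → suc n C 2 ≡ n + n C 2
[1+n]C2≡n+nC2 n = trans (sym (nCk+nC[k+1]≡[n+1]C[k+1] n 1)) (cong (_+ n C 2) (nC1≡n n))

∑-toℕ : ∀ k → ∑[ i < k ] toℕ i ≡ k C 2
∑-toℕ zero    = refl
∑-toℕ (suc k) = begin
  ∑[ i < k ] (1 + toℕ i)            ≡⟨ ∑-distrib-+ {k} (λ _ → 1) toℕ ⟩
  ∑[ i < k ] 1 + ∑[ i < k ] toℕ i   ≡⟨ cong₂ _+_ (∑-one k) (∑-toℕ k) ⟩
  k + k C 2                         ≡⟨ [1+n]C2≡n+nC2 k ⟨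
  suc k C 2                         ∎
  where open ≡-Reasoning

sumˡ-tabulate : ∀ {k} (f : Fin k → ℕ) → sumˡ (tabulate f) ≡ ∑[ i < k ] f i
sumˡ-tabulate {zero}  f = refl
sumˡ-tabulate {suc k} f = cong (f zero +_) (sumˡ-tabulate (f ∘ suc))

sumˡ-allFin : ∀ {k} (f : Fin k → ℕ) → sumˡ (map f (allFin k)) ≡ ∑[ i < k ] f i
sumˡ-allFin f = trans (cong sumˡ (map-tabulate id f)) (sumˡ-tabulate f)

gap : ∀ {k} → Fin k → Fin k → ℕ
gap a b = ∣ toℕ a - toℕ b ∣

gap-comm : ∀ {k} (a b : Fin k) → gap a b ≡ gap b a
gap-comm a b = ∣-∣-comm (toℕ a) (toℕ b)

gap-self : ∀ {k} (a : Fin k) → gap a a ≡ 0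
gap-self a = ∣n-n∣≡0 (toℕ a)

gap-≢ : ∀ {k} {a b : Fin k} → a ≢ b → 1 ≤ gap a b
gap-≢ a≢b = n≢0⇒n>0 (a≢b ∘ toℕ-injective ∘ ∣m-n∣≡0⇒m≡n)

when : Bool → ℕ → ℕ
when b x = if b then x else 0

when-≤ : ∀ b x → when b x ≤ x
when-≤ true  x = ≤-refl
when-≤ false x = z≤n

when-0 : ∀ b → when b 0 ≡ 0
when-0 true  = refl
when-0 false = refl

when-split : ∀ {a b} {A : Set a} {B : Set b} (a? : Dec A) (b? : Dec B) {x} →
             (¬ A → ¬ B → x ≤ 0) → x ≤ when (does a?) x + when (does b?) x
when-split (yes _) _       _   = m≤m+n _ _
when-split (no _)  (yes _) _   = ≤-refl
when-split (no ¬a) (no ¬b) x≤0 = x≤0 ¬a ¬b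

when-pair : ∀ {a} {A : Set a} (a? : Dec A) {x y z} →
            (A → x + y ≤ z) → when (does a?) x + when (does a?) y ≤ when (does a?) z
when-pair (yes a) x+y≤z = x+y≤z a
when-pair (no _)  _     = z≤n

edgeTerm : ∀ {n} → Graph n → Arrangement n → Fin n → Fin n → ℕ
edgeTerm G π u v = when (does (u <? v)) (when (adj G u v) (gap (π ⟨$⟩ʳ u) (π ⟨$⟩ʳ v)))

D≡∑∑ : ∀ {n} (G : Graph n) (π : Arrangement n) → D G π ≡ ∑[ u < n ] ∑[ v < n ] edgeTerm G π u v
D≡∑∑ G π = trans (sumˡ-allFin (λ u → sumˡ (map (edgeTerm G π u) (allFin _))))
  (sum-cong-≗ (λ u → sumˡ-allFin (edgeTerm G π u)))

∑∑-distrib-+ : ∀ {k l} (f g : Fin k → Fin l → ℕ) →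
  ∑[ u < k ] ∑[ v < l ] (f u v + g u v) ≡ ∑[ u < k ] ∑[ v < l ] f u v + ∑[ u < k ] ∑[ v < l ] g u v
∑∑-distrib-+ {k} {l} f g = trans (sum-cong-≗ (λ u → ∑-distrib-+ (f u) (g u)))
  (∑-distrib-+ {k} (λ u → ∑[ v < l ] f u v) (λ u → ∑[ v < l ] g u v))

-- toParent u selects the edge from u to its parent; as P has no 2-cycles, an edge is
-- selected from at most one of its endpoints.
module _ {n} (G : Graph n) (π : Arrangement n) (P : Fin n → Fin n)
         (P-adj : ∀ u → P u ≢ u → Adj G u (P u))
         (P-no-2-cycle : ∀ u → P (P u) ≡ u → P u ≡ u) where

  private
    len : Fin n → Fin n → ℕ
    len u v = gap (π ⟨$⟩ʳ u) (π ⟨$⟩ʳ v)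

    toParent : Fin n → Fin n → ℕ
    toParent u v = when (does (v ≟ P u)) (len u v)

    toParent-self : ∀ u → toParent u (P u) ≡ len u (P u)
    toParent-self u = cong (λ b → when b (len u (P u))) (dec-true (P u ≟ P u) refl)

    toParent-elsewhere : ∀ u v → v ≢ P u → toParent u v ≡ 0
    toParent-elsewhere u v v≢Pu = cong (λ b → when b (len u v)) (dec-false (v ≟ P u) v≢Pu)

    ascending descending : Fin n → Fin n → ℕ
    ascending  u v = when (does (u <? v)) (toParent u v)
    descending u v = when (does (v <? u)) (toParent u v)

    split : ∀ u v → toParent u v ≤ ascending u v + descending u v
    split u v = when-split (u <? v) (v <? u) λ u≮v v≮u →
      let u≡v = toℕ-injective (≤-antisym (≮⇒≥ v≮u) (≮⇒≥ u≮v)) in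
      ≤-trans (when-≤ _ (len u v)) (≤-reflexive (trans (cong (len u) (sym u≡v)) (gap-self (π ⟨$⟩ʳ u))))

    adj-parent : ∀ {u v} → v ≡ P u → u ≢ v → Adj G u v
    adj-parent {u} refl u≢Pu = P-adj u (u≢Pu ∘ sym)

    pair≤adjGap : ∀ u v → toℕ u < toℕ v → toParent u v + toParent v u ≤ when (adj G u v) (len u v)
    pair≤adjGap u v u<v with v ≟ P u | u ≟ P v
    ... | yes v≡Pu | yes u≡Pv =
          contradiction (sym (trans v≡Pu (P-no-2-cycle u (trans (cong P (sym v≡Pu)) (sym u≡Pv))))) (<⇒≢ u<v)
    ... | yes v≡Pu | no _ rewrite adj-parent v≡Pu (<⇒≢ u<v) = ≤-reflexive (+-identityʳ (len u v))
    ... | no _ | yes u≡Pv rewrite trans (Graph.sym G u v) (adj-parent u≡Pv (<⇒≢ u<v ∘ sym))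
        = ≤-reflexive (gap-comm (π ⟨$⟩ʳ v) (π ⟨$⟩ʳ u))
    ... | no _ | no _ = z≤n

  ∑-parentGap≤D : ∑[ u < n ] len u (P u) ≤ D G π
  ∑-parentGap≤D = begin
    ∑[ u < n ] len u (P u)
      ≡⟨ sum-cong-≗ (λ u → trans (∑-select (toParent u) (P u) (toParent-elsewhere u)) (toParent-self u)) ⟨
    ∑[ u < n ] ∑[ v < n ] toParent u v
      ≤⟨ ∑-mono-≤ (λ u → ∑-mono-≤ (split u)) ⟩
    ∑[ u < n ] ∑[ v < n ] (ascending u v + descending u v)
      ≡⟨ ∑∑-distrib-+ ascending descending ⟩
    ∑[ u < n ] ∑[ v < n ] ascending u v + ∑[ u < n ] ∑[ v < n ] descending u v
      ≡⟨ cong (∑[ u < n ] ∑[ v < n ] ascending u v +_) (∑-comm descending) ⟩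
    ∑[ u < n ] ∑[ v < n ] ascending u v + ∑[ u < n ] ∑[ v < n ] descending v u
      ≡⟨ ∑∑-distrib-+ ascending (λ u v → descending v u) ⟨
    ∑[ u < n ] ∑[ v < n ] (ascending u v + descending v u)
      ≤⟨ ∑-mono-≤ (λ u → ∑-mono-≤ (λ v → when-pair (u <? v) (pair≤adjGap u v))) ⟩
    ∑[ u < n ] ∑[ v < n ] edgeTerm G π u v
      ≡⟨ D≡∑∑ G π ⟨
    D G π ∎
    where open ≤-Reasoning

D-star : ∀ m (π : Arrangement (suc m)) → D (star m) π ≡ ∑[ v < suc m ] gap (π ⟨$⟩ʳ zero) (π ⟨$⟩ʳ v)
D-star m π = begin
  D (star m) π
    ≡⟨ D≡∑∑ (star m) π ⟩
  ∑[ v < suc m ] edgeTerm (star m) π zero v + ∑[ u < m ] ∑[ v < suc m ] edgeTerm (star m) π (suc u) v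
    ≡⟨ cong₂ _+_ (cong (_+ ∑[ v < m ] gap (π ⟨$⟩ʳ zero) (π ⟨$⟩ʳ suc v)) (sym (gap-self (π ⟨$⟩ʳ zero)))) (∑-zero (λ u → ∑-zero (leaf-row u))) ⟩
  ∑[ v < suc m ] gap (π ⟨$⟩ʳ zero) (π ⟨$⟩ʳ v) + 0
    ≡⟨ +-identityʳ _ ⟩
  ∑[ v < suc m ] gap (π ⟨$⟩ʳ zero) (π ⟨$⟩ʳ v) ∎
  where
  open ≡-Reasoning
  leaf-row : ∀ u v → edgeTerm (star m) π (suc u) v ≡ 0
  leaf-row u zero    = refl
  leaf-row u (suc v) = when-0 (does (suc u <? suc v))

-- The sum is C(p+1,2) + C(r+1,2), short of C(p+r+1,2) by exactly p r.
∑∣p-j∣+p*r≡C2 : ∀ p r → ∑[ j < suc (p + r) ] ∣ p - toℕ j ∣ + p * r ≡ suc (p + r) C 2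
∑∣p-j∣+p*r≡C2 zero    r = trans (+-identityʳ _) (∑-toℕ (suc r))
∑∣p-j∣+p*r≡C2 (suc p) r = begin
  suc p + S + suc p * r          ≡⟨ rearrange p r S ⟩
  suc (p + r) + (S + p * r)      ≡⟨ cong (suc (p + r) +_) (∑∣p-j∣+p*r≡C2 p r) ⟩
  suc (p + r) + suc (p + r) C 2  ≡⟨ [1+n]C2≡n+nC2 (suc (p + r)) ⟨
  suc (suc p + r) C 2            ∎
  where
  open ≡-Reasoning
  S = ∑[ j < suc (p + r) ] ∣ p - toℕ j ∣
  rearrange : ∀ p r s → suc p + s + suc p * r ≡ suc (p + r) + (s + p * r)
  rearrange = solve-∀

∑∣p-j∣≤C2 : ∀ {p m} → p ≤ m → ∑[ j < suc m ] ∣ p - toℕ j ∣ ≤ suc m C 2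
∑∣p-j∣≤C2 {p} p≤m with r , refl ← m≤n⇒∃[o]m+o≡n p≤m =
  subst (∑[ j < suc (p + r) ] ∣ p - toℕ j ∣ ≤_) (∑∣p-j∣+p*r≡C2 p r) (m≤m+n _ (p * r))

star-isDmax : ∀ m → IsDmax (star m) (suc m C 2)
star-isDmax m = (Perm.id , trans (D-star m Perm.id) (∑-toℕ (suc m))) , λ π → begin
  D (star m) π                                  ≡⟨ D-star m π ⟩
  ∑[ v < suc m ] gap (π ⟨$⟩ʳ zero) (π ⟨$⟩ʳ v)   ≡⟨ ∑-permute (gap (π ⟨$⟩ʳ zero)) π ⟨
  ∑[ j < suc m ] gap (π ⟨$⟩ʳ zero) j            ≤⟨ ∑∣p-j∣≤C2 (≤-pred (toℕ<n (π ⟨$⟩ʳ zero))) ⟩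
  suc m C 2                                     ∎
  where open ≤-Reasoning

-- The cut c lies between the positions c − 1 and c.
Separates : ℕ → ℕ → ℕ → Set
Separates c a b = a < c × c ≤ b

Crosses : ℕ → ℕ → ℕ → Set
Crosses c a b = Separates c a b ⊎ Separates c b a

toℕ-punchIn-< : ∀ {k} (q : Fin (suc k)) (a : Fin k) → toℕ a < toℕ q → toℕ (punchIn q a) ≡ toℕ a
toℕ-punchIn-< (suc q) zero    _         = refl
toℕ-punchIn-< (suc q) (suc a) (s≤s a<q) = cong suc (toℕ-punchIn-< q a a<q)

toℕ-punchIn-≥ : ∀ {k} (q : Fin (suc k)) (a : Fin k) → toℕ q ≤ toℕ a → toℕ (punchIn q a) ≡ suc (toℕ a)
toℕ-punchIn-≥ zero    a       _         = refl
toℕ-punchIn-≥ (suc q) (suc a) (s≤s q≤a) = cong suc (toℕ-punchIn-≥ q a q≤a)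

∣m-1+n∣≡1+∣m-n∣ : ∀ {m n} → m ≤ n → ∣ m - suc n ∣ ≡ suc ∣ m - n ∣
∣m-1+n∣≡1+∣m-n∣ {m} {n} m≤n = begin
  ∣ m - suc n ∣  ≡⟨ m≤n⇒∣m-n∣≡n∸m (m≤n⇒m≤1+n m≤n) ⟩
  suc n ∸ m      ≡⟨ +-∸-assoc 1 m≤n ⟩
  suc (n ∸ m)    ≡⟨ cong suc (m≤n⇒∣m-n∣≡n∸m m≤n) ⟨
  suc ∣ m - n ∣  ∎
  where open ≡-Reasoning

punchIn-separates : ∀ {k} (q : Fin (suc k)) {a b : Fin k} {c} → toℕ q ≤ c → c ≤ suc (toℕ q) →
  Separates (toℕ q) (toℕ a) (toℕ b) →
  Separates c (toℕ (punchIn q a)) (toℕ (punchIn q b)) × gap (punchIn q a) (punchIn q b) ≡ suc (gap a b)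
punchIn-separates q {a} {b} q≤c c≤1+q (a<q , q≤b)
  rewrite toℕ-punchIn-< q a a<q | toℕ-punchIn-≥ q b q≤b
  = (<-≤-trans a<q q≤c , ≤-trans c≤1+q (s≤s q≤b)) , ∣m-1+n∣≡1+∣m-n∣ (<⇒≤ (<-≤-trans a<q q≤b))

punchIn-crosses : ∀ {k} (q : Fin (suc k)) {a b : Fin k} {c} → toℕ q ≤ c → c ≤ suc (toℕ q) →
  Crosses (toℕ q) (toℕ a) (toℕ b) →
  Crosses c (toℕ (punchIn q a)) (toℕ (punchIn q b)) × gap (punchIn q a) (punchIn q b) ≡ suc (gap a b)
punchIn-crosses q q≤c c≤1+q (inj₁ a|b) = Product.map₁ inj₁ (punchIn-separates q q≤c c≤1+q a|b)
punchIn-crosses q {a} {b} q≤c c≤1+q (inj₂ b|a) with b|a′ , stretched ← punchIn-separates q q≤c c≤1+q b|a =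
  inj₂ b|a′ , trans (gap-comm (punchIn q a) (punchIn q b)) (trans stretched (cong suc (gap-comm b a)))

separating-cut : ∀ {k} (q : Fin (suc k)) (a : Fin k) → ∃ λ (c : Fin (suc (suc k))) →
  toℕ q ≤ toℕ c × toℕ c ≤ suc (toℕ q) × Crosses (toℕ c) (toℕ q) (toℕ (punchIn q a))
separating-cut q a with a <? q
... | yes a<q = inject₁ q , cut-at-q
  where
  cut-at-q : toℕ q ≤ toℕ (inject₁ q) × toℕ (inject₁ q) ≤ suc (toℕ q) × Crosses (toℕ (inject₁ q)) (toℕ q) (toℕ (punchIn q a))
  cut-at-q rewrite toℕ-inject₁ q | toℕ-punchIn-< q a a<q = ≤-refl , n≤1+n _ , inj₂ (a<q , ≤-refl)
... | no a≮q rewrite toℕ-punchIn-≥ q a (≮⇒≥ a≮q) = suc q , n≤1+n _ , ≤-refl , inj₁ (n<1+n _ , s≤s (≮⇒≥ a≮q))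

boundary-edge : ∀ {n} {G : Graph n} {p} {P : Pred (Fin n) p} → Decidable P →
  ∀ {u v} → Walk G u v → P u → ¬ P v → ∃₂ λ x y → P x × ¬ P y × Adj G x y
boundary-edge P? here Pu ¬Pv = contradiction Pu ¬Pv
boundary-edge P? (step {w = w} u~w walk) Pu ¬Pv with P? w
... | yes Pw  = boundary-edge P? walk Pw ¬Pv
... | no ¬Pw = _ , _ , Pu , ¬Pw , u~w

outside-image : ∀ {k n} (f : Fin k → Fin n) → k < n → ∃ λ y → ∀ i → f i ≢ y
outside-image {k} {n} f k<n with all? (λ y → any? (λ i → f i ≟ y))
... | no ¬all = Product.map₂ (λ ¬hit i fi≡y → ¬hit (i , fi≡y)) (¬∀⟶∃¬ n _ (λ y → any? (λ i → f i ≟ y)) ¬all)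
... | yes hit = contradiction (injective⇒≤ section-injective) (<⇒≱ k<n)
  where
  section-injective : Injective _≡_ _≡_ (proj₁ ∘ hit)
  section-injective {y} {y′} e = trans (sym (proj₂ (hit y))) (trans (cong f e) (proj₂ (hit y′)))

injective⇒surjective : ∀ {n} {f : Fin n → Fin n} → Injective _≡_ _≡_ f → ∀ y → ∃ λ x → f x ≡ y
injective⇒surjective {suc n} {f} f-injective y with any? (λ x → f x ≟ y)
... | yes hit  = hit
... | no ¬hit = contradiction (injective⇒≤ punchOut-f-injective) 1+n≰n
  where
  y≢f : ∀ x → y ≢ f x
  y≢f x e = ¬hit (x , sym e)
  punchOut-f-injective : Injective _≡_ _≡_ (λ x → punchOut (y≢f x))
  punchOut-f-injective e = f-injective (punchOut-injective (y≢f _) (y≢f _) e)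

fromℕ-or-inject₁ : ∀ {k} (i : Fin (suc k)) → i ≡ fromℕ k ⊎ ∃ λ j → i ≡ inject₁ j
fromℕ-or-inject₁ {zero}  zero    = inj₁ refl
fromℕ-or-inject₁ {suc k} zero    = inj₂ (zero , refl)
fromℕ-or-inject₁ {suc k} (suc i) = Sum.map (cong suc) (Product.map suc (cong suc)) (fromℕ-or-inject₁ i)

increasing⇒no-2-cycle : ∀ {k} (f : Fin k → Fin k) → (∀ i → f i ≡ i ⊎ toℕ i < toℕ (f i)) → ∀ i → f (f i) ≡ i → f i ≡ i
increasing⇒no-2-cycle f increasing i ffi≡i with increasing i | increasing (f i)
... | inj₁ fi≡i | _           = fi≡i
... | inj₂ i<fi | inj₁ ffi≡fi = contradiction (trans (sym ffi≡fi) ffi≡i) (<⇒≢ i<fi ∘ sym)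
... | inj₂ i<fi | inj₂ fi<ffi = contradiction (<-trans i<fi (subst (λ j → toℕ (f i) < toℕ j) ffi≡i fi<ffi)) (<-irrefl refl)

module Layouts {n} (G : Graph n) where

  -- Index 0 is the vertex placed last and fromℕ k the root. ParentEdge i is the edge from
  -- the non-root index inject₁ i to its parent, lengthened by each of the toℕ i later insertions.
  record ParentEdge {k} (vertex : Fin (suc k) → Fin n) (position : Permutation′ (suc k)) (cut : ℕ)
                    (i : Fin k) (j : Fin (suc k)) : Set where
    field
      index<   : toℕ (inject₁ i) < toℕ j
      adjacent : Adj G (vertex (inject₁ i)) (vertex j)
      crosses  : Crosses cut (toℕ (position ⟨$⟩ʳ inject₁ i)) (toℕ (position ⟨$⟩ʳ j))
      long     : suc (toℕ i) ≤ gap (position ⟨$⟩ʳ inject₁ i) (position ⟨$⟩ʳ j)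

  record Layout (k : ℕ) : Set where
    field
      vertex           : Fin (suc k) → Fin n
      vertex-injective : Injective _≡_ _≡_ vertex
      position         : Permutation′ (suc k)
      cut              : Fin (suc (suc k))
      parent           : Fin (suc k) → Fin (suc k)
      parent-root      : parent (fromℕ k) ≡ fromℕ k
      parent-edge      : ∀ i → ParentEdge vertex position (toℕ cut) i (parent (inject₁ i))

  singleton : Fin n → Layout 0
  singleton r = record
    { vertex           = λ _ → r
    ; vertex-injective = λ { {zero} {zero} _ → refl }
    ; position         = Perm.id
    ; cut              = zero
    ; parent           = id
    ; parent-root      = refl
    ; parent-edge      = λ ()
    }

  extend : ∀ {k} (L : Layout k) (x : Fin n) → (∀ i → Layout.vertex L i ≢ x) →
           ∀ j → Adj G x (Layout.vertex L j) → Layout (suc k)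
  extend L x x-new j x~j = record
    { vertex           = x ∷ vertex
    ; vertex-injective = x∷vertex-injective
    ; position         = Perm.insert zero cut position
    ; cut              = proj₁ new-cut
    ; parent           = suc j ∷ (suc ∘ parent)
    ; parent-root      = cong suc parent-root
    ; parent-edge      = λ { zero → new-edge ; (suc i) → stretched-edge i }
    }
    where
    open Layout L
    new-cut = separating-cut cut (position ⟨$⟩ʳ j)
    c = proj₁ new-cut
    cut≤c = proj₁ (proj₂ new-cut)
    c≤1+cut = proj₁ (proj₂ (proj₂ new-cut))

    x∷vertex-injective : Injective _≡_ _≡_ (x ∷ vertex)
    x∷vertex-injective {zero}  {zero}  _ = refl
    x∷vertex-injective {zero}  {suc i} e = contradiction (sym e) (x-new i)
    x∷vertex-injective {suc i} {zero}  e = contradiction e (x-new i)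
    x∷vertex-injective {suc i} {suc j} e = cong suc (vertex-injective e)

    new-edge : ParentEdge (x ∷ vertex) (Perm.insert zero cut position) (toℕ c) zero (suc j)
    new-edge = record
      { index<   = s≤s z≤n
      ; adjacent = x~j
      ; crosses  = proj₂ (proj₂ (proj₂ new-cut))
      ; long     = gap-≢ (punchInᵢ≢i cut (position ⟨$⟩ʳ j) ∘ sym)
      }

    stretched-edge : ∀ i → ParentEdge (x ∷ vertex) (Perm.insert zero cut position) (toℕ c) (suc i) (suc (parent (inject₁ i)))
    stretched-edge i = record
      { index<   = s≤s index<
      ; adjacent = adjacent
      ; crosses  = proj₁ stretched
      ; long     = subst (suc (suc (toℕ i)) ≤_) (sym (proj₂ stretched)) (s≤s long)
      }
      where
      open ParentEdge (parent-edge i)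
      stretched = punchIn-crosses cut cut≤c c≤1+cut crosses

  grow : Connected G → ∀ {k} → Layout k → suc k < n → Layout (suc k)
  grow connected {k} L k+1<n =
    extend-along (boundary-edge placed? (connected (vertex zero) y) (zero , refl) (λ (i , e) → y-new i e))
    where
    open Layout L
    Placed : Pred (Fin n) _
    Placed z = ∃ λ i → vertex i ≡ z
    placed? : Decidable Placed
    placed? z = any? (λ i → vertex i ≟ z)
    y = proj₁ (outside-image vertex k+1<n)
    y-new = proj₂ (outside-image vertex k+1<n)
    extend-along : (∃₂ λ v x → Placed v × ¬ Placed x × Adj G v x) → Layout (suc k)
    extend-along (_ , x , (i , refl) , x-new , vᵢ~x) =
      extend L x (λ i e → x-new (i , e)) i (trans (Graph.sym G x (vertex i)) vᵢ~x)

  layout : Connected G → Fin n → ∀ k → k < n → Layout k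
  layout connected r zero    _     = singleton r
  layout connected r (suc k) k+1<n = grow connected (layout connected r k (<-trans (n<1+n k) k+1<n)) k+1<n

module _ {m} {G : Graph (suc m)} (L : Layouts.Layout G m) where
  open Layouts G
  open Layout L

  private
    W : Permutation′ (suc m)
    W = Perm.permutation vertex (proj₁ ∘ onto) (proj₂ ∘ onto) (λ i → vertex-injective (proj₂ (onto (vertex i))))
      where onto = injective⇒surjective vertex-injective

    index : Fin (suc m) → Fin (suc m)
    index u = W ⟨$⟩ˡ u

    π : Arrangement (suc m)
    π = Perm.flip W ∘ₚ position

    P : Fin (suc m) → Fin (suc m)
    P u = vertex (parent (index u))

    parentGap : Fin (suc m) → ℕ
    parentGap i = gap (position ⟨$⟩ʳ i) (position ⟨$⟩ʳ parent i)

    parent-root-or-edge : ∀ i → parent i ≡ i ⊎ (toℕ i < toℕ (parent i) × Adj G (vertex i) (vertex (parent i)))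
    parent-root-or-edge i with fromℕ-or-inject₁ i
    ... | inj₁ refl       = inj₁ parent-root
    ... | inj₂ (j , refl) = inj₂ (index< , adjacent) where open ParentEdge (parent-edge j)

    P-adj : ∀ u → P u ≢ u → Adj G u (P u)
    P-adj u Pu≢u with parent-root-or-edge (index u)
    ... | inj₁ root      = contradiction (trans (cong vertex root) (Perm.inverseʳ W)) Pu≢u
    ... | inj₂ (_ , adj) = subst (λ v → Adj G v (P u)) (Perm.inverseʳ W) adj

    P-no-2-cycle : ∀ u → P (P u) ≡ u → P u ≡ u
    P-no-2-cycle u PPu≡u = begin
      vertex (parent (index u))
        ≡⟨ cong vertex (increasing⇒no-2-cycle parent (Sum.map₂ proj₁ ∘ parent-root-or-edge) (index u) parent²≡id) ⟩
      vertex (index u)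
        ≡⟨ Perm.inverseʳ W ⟩
      u ∎
      where
      open ≡-Reasoning
      parent²≡id : parent (parent (index u)) ≡ index u
      parent²≡id = vertex-injective (begin
        vertex (parent (parent (index u)))                   ≡⟨ cong (vertex ∘ parent) (Perm.inverseˡ W) ⟨
        vertex (parent (index (vertex (parent (index u)))))  ≡⟨ PPu≡u ⟩
        u                                                    ≡⟨ Perm.inverseʳ W ⟨
        vertex (index u)                                     ∎)

    ∑-parentGap-reindex : ∑[ u < suc m ] gap (π ⟨$⟩ʳ u) (π ⟨$⟩ʳ P u) ≡ ∑[ i < suc m ] parentGap i
    ∑-parentGap-reindex = begin
      ∑[ u < suc m ] gap (π ⟨$⟩ʳ u) (π ⟨$⟩ʳ P u)  ≡⟨ sum-cong-≗ (λ u → cong (gap (π ⟨$⟩ʳ u) ∘ (position ⟨$⟩ʳ_)) (Perm.inverseˡ W {parent (index u)})) ⟩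
      ∑[ u < suc m ] parentGap (index u)          ≡⟨ ∑-permute (parentGap ∘ index) W ⟩
      ∑[ i < suc m ] parentGap (index (vertex i)) ≡⟨ sum-cong-≗ (λ i → cong parentGap (Perm.inverseˡ W {i})) ⟩
      ∑[ i < suc m ] parentGap i                  ∎
      where open ≡-Reasoning

    C2≤∑-parentGap : suc m C 2 ≤ ∑[ i < suc m ] parentGap i
    C2≤∑-parentGap = begin
      suc m C 2                                               ≡⟨ ∑-toℕ (suc m) ⟨
      ∑[ i < m ] suc (toℕ i)                                  ≤⟨ ∑-mono-≤ (λ i → ParentEdge.long (parent-edge i)) ⟩
      ∑[ i < m ] parentGap (inject₁ i)                        ≤⟨ m≤m+n _ _ ⟩
      ∑[ i < m ] parentGap (inject₁ i) + parentGap (fromℕ m)  ≡⟨ sum-init-last parentGap ⟨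
      ∑[ i < suc m ] parentGap i                              ∎
      where open ≤-Reasoning

  layout⇒C2≤D : ∃ λ π → suc m C 2 ≤ D G π
  layout⇒C2≤D = π , ≤-trans C2≤∑-parentGap (subst (_≤ D G π) ∑-parentGap-reindex (∑-parentGap≤D G π P P-adj P-no-2-cycle))

connected⇒C2≤D : ∀ {m} (G : Graph (suc m)) → Connected G → ∃ λ π → suc m C 2 ≤ D G π
connected⇒C2≤D {m} G connected = layout⇒C2≤D (Layouts.layout G connected zero m (n<1+n m))

theorem6 : (m : ℕ) →
    IsDmax (star m) (suc m C 2) ×
    ((t : Graph (suc m)) → IsTree t → (d : ℕ) → IsDmax t d → suc m C 2 ≤ d)
theorem6 m = star-isDmax m , λ t (connected , _) d (_ , maximal) →
  let π , C2≤Dπ = connected⇒C2≤D t connected in ≤-trans C2≤Dπ (maximal π)
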